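{- Let $d$ be an odd positive integer and $e$ an even non-negative integer. In the Blocking universe $B$: \begin{enumerate} \item $e\circledcirc\equiv_B 0$; \item $d\circledcirc\equiv_B 1\circledcirc$; \item $\circledcirc 1+1\circledcirc\equiv_B 0$. \end{enumerate} Here $k\circledcirc$ denotes the \textsc{cricket pitch} position consisting of a single bump of size $k$ to the left of the roller (for $k=0$ this is the position with no bumps, i.e. the game $0$ in which neither player can move), and $\circledcirc 1$ the position with a single bump of size $1$ to the right of the roller.
   Context: Games are short two-player combinatorial games (Left and Right) under the mis\`ere convention: the player unable to move on their turn wins. $G+H$ is the disjunctive sum (on a turn a player moves in exactly one component). $o(G)$ is the outcome class ($\mathcal{L},\mathcal{R},\mathcal{N},\mathcal{P}$: Left wins, Right wins, first player wins, second player wins). A game $G$ is Blocking if for every position $H$ of $G$ (including $G$): whenever Left has no move in $H$, then in every Right option $H^R$ either Left has no move or there is a Left option $H^{RL}$ of $H^R$ in which Left has no move; and symmetrically with Left and Right interchanged. $B$ is the universe of Blocking games, and for $G,H\in B$, $G\equiv_B H$ means $o(G+X)=o(H+X)$ for all $X\in B$. \textsc{cricket pitch}: a row of bumps (non-negative integers) with a roller $\circledcirc$; Left moves the roller left and Right moves it right over any positive number of consecutive bumps, each bump rolled over decreasing by $1$; bumps of size $0$ cannot be rolled over. \textsc{cricket pitch} positions are Blocking games. -}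

module Defs where

open import Data.Nat using (ℕ; zero; suc; _+_; _*_)
open import Data.Fin using (Fin; splitAt)
open import Data.Bool using (Bool; true; false; _∨_; _∧_; not)
open import Data.Sum using (_⊎_; inj₁; inj₂; [_,_])
open import Data.Product using (Σ; _×_; ∃)
open import Relation.Binary.PropositionalEquality using (_≡_)

data Game : Set where
  mk : (nL : ℕ) → (Fin nL → Game) → (nR : ℕ) → (Fin nR → Game) → Game

nL : Game → ℕ
nL (mk a _ _ _) = a

nR : Game → ℕ
nR (mk _ _ b _) = b

optL : (G : Game) → Fin (nL G) → Game
optL (mk _ L _ _) = L

optR : (G : Game) → Fin (nR G) → Game
optR (mk _ _ _ R) = R

zeroG : Game
zeroG = mk 0 (λ ()) 0 (λ ())

infixl 6 _⊕_
_⊕_ : Game → Game → Game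
G@(mk a L b R) ⊕ H@(mk c L' d R') =
  mk (a + c) (λ k → [ (λ i → L i ⊕ H) , (λ j → G ⊕ L' j) ] (splitAt a k))
     (b + d) (λ k → [ (λ i → R i ⊕ H) , (λ j → G ⊕ R' j) ] (splitAt b k))

-- Misère play: a player unable to move on their turn WINS.

isZero : ℕ → Bool
isZero zero = true
isZero (suc _) = false

anyFin : (n : ℕ) → (Fin n → Bool) → Bool
anyFin zero f = false
anyFin (suc n) f = f Fin.zero ∨ anyFin n (λ i → f (Fin.suc i))
  where import Data.Fin as Fin

-- leftFirst G  : Left, moving first in G, wins (misère)
-- rightFirst G : Right, moving first in G, wins (misère)
leftFirst  : Game → Bool
rightFirst : Game → Bool
leftFirst (mk a L b R) =
  isZero a ∨ anyFin a (λ i → not (rightFirst (L i)))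
rightFirst (mk a L b R) =
  isZero b ∨ anyFin b (λ j → not (leftFirst (R j)))

data Outcome : Set where
  𝓛 𝓡 𝓝 𝓟 : Outcome

outcomeOf : Bool → Bool → Outcome
outcomeOf true  true  = 𝓝
outcomeOf true  false = 𝓛
outcomeOf false true  = 𝓡
outcomeOf false false = 𝓟

o : Game → Outcome
o G = outcomeOf (leftFirst G) (rightFirst G)

data IsPosition : Game → Game → Set where
  here  : ∀ {G} → IsPosition G G
  viaL  : ∀ {H G} (i : Fin (nL G)) → IsPosition H (optL G i) → IsPosition H G
  viaR  : ∀ {H G} (j : Fin (nR G)) → IsPosition H (optR G j) → IsPosition H G

NoLeftMove : Game → Set
NoLeftMove H = nL H ≡ 0

NoRightMove : Game → Set
NoRightMove H = nR H ≡ 0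

BlockingAt : Game → Set
BlockingAt H =
  (NoLeftMove H → (j : Fin (nR H)) →
     NoLeftMove (optR H j)
     ⊎ Σ (Fin (nL (optR H j))) (λ i → NoLeftMove (optL (optR H j) i)))
  × (NoRightMove H → (i : Fin (nL H)) →
     NoRightMove (optL H i)
     ⊎ Σ (Fin (nR (optL H i))) (λ j → NoRightMove (optR (optL H i) j)))

Blocking : Game → Set
Blocking G = (H : Game) → IsPosition H G → BlockingAt H

_≡B_ : Game → Game → Set
G ≡B H = (X : Game) → Blocking X → o (G ⊕ X) ≡ o (H ⊕ X)

-- Cricket pitch positions with a single bump.
-- bumpL k = "k ⊚" : bump of size k immediately left of the roller.
-- bumpR k = "⊚ k" : bump of size k immediately right of the roller.
-- From k⊚ (k>0) Left rolls left over the bump, leaving ⊚(k-1); Right has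
-- no bump to the right, so no move.  Symmetrically for ⊚k.  A bump of
-- size 0 cannot be rolled over, so 0⊚ = ⊚0 = 0.

bumpL : ℕ → Game
bumpR : ℕ → Game
bumpL zero    = zeroG
bumpL (suc k) = mk 1 (λ _ → bumpR k) 0 (λ ())
bumpR zero    = zeroG
bumpR (suc k) = mk 0 (λ ()) 1 (λ _ → bumpL k)

Even : ℕ → Set
Even n = ∃ λ m → n ≡ 2 * m

Odd : ℕ → Set
Odd n = ∃ λ m → n ≡ 2 * m + 1

module Submission where

-- Let G be a game each of whose Left options is a Left end with at least one Right option, all
-- of them Left-neutral, and dually for its Right options. Then G ≡ 0 in B: in G + X, a Left move
-- to G^L + X is reversed by Right moving to the Left-neutral G^LR + X, and if X is a Left end then
-- Left, moving second, wins G^L + X thanks to the Blocking condition on X. This gives e⊚ ≡ 0 by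
-- induction on e, and ⊚1 + 1⊚ ≡ 0. Any two Right ends whose Left options are all Right-neutral
-- are equivalent, since a Left move in one can be replaced by a Left move in the other; d⊚ and 1⊚
-- are such games, their Left options ⊚(d−1) and ⊚0 being ≡ 0.

open import Defs
open import Data.Nat using (ℕ; zero; suc; _+_; _*_)
open import Data.Nat.Properties using (*-suc; +-comm; m+n≡0⇒m≡0; m+n≡0⇒n≡0)
open import Data.Fin using (Fin; splitAt; _↑ˡ_; _↑ʳ_) renaming (zero to fzero; suc to fsuc)
open import Data.Fin.Properties using (splitAt-↑ˡ; splitAt-↑ʳ; ¬Fin0)
open import Data.Bool using (Bool; true; false; _∨_; not)
open import Data.Bool.Properties using (∨-zeroʳ; not-injective; ¬-not; not-¬; ⇔→≡)
open import Data.Empty using (⊥; ⊥-elim)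
open import Data.Sum using (_⊎_; inj₁; inj₂)
open import Data.Product using (_×_; _,_; ∃; proj₁; proj₂; uncurry)
import Data.Product as Product
open import Function using (_∘_; id)
open import Function.Bundles using (mk⇔)
open import Relation.Binary.PropositionalEquality
  using (_≡_; refl; sym; trans; cong; cong₂; subst)

anyFin-true⁺ : ∀ n (f : Fin n → Bool) i → f i ≡ true → anyFin n f ≡ true
anyFin-true⁺ (suc n) f fzero    p rewrite p = refl
anyFin-true⁺ (suc n) f (fsuc i) p =
  trans (cong (f fzero ∨_) (anyFin-true⁺ n (f ∘ fsuc) i p)) (∨-zeroʳ (f fzero))

anyFin-true⁻ : ∀ n (f : Fin n → Bool) → anyFin n f ≡ true → ∃ λ i → f i ≡ true
anyFin-true⁻ (suc n) f p with f fzero in eq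
... | true  = fzero , eq
... | false = Product.map fsuc id (anyFin-true⁻ n (f ∘ fsuc) p)

leftFirst-noMove : ∀ {G} → NoLeftMove G → leftFirst G ≡ true
leftFirst-noMove {mk zero _ _ _} _ = refl

rightFirst-noMove : ∀ {G} → NoRightMove G → rightFirst G ≡ true
rightFirst-noMove {mk _ _ zero _} _ = refl

leftFirst-move : ∀ {G} i → rightFirst (optL G i) ≡ false → leftFirst G ≡ true
leftFirst-move {mk a _ _ _} i p =
  trans (cong (isZero a ∨_) (anyFin-true⁺ a _ i (cong not p))) (∨-zeroʳ (isZero a))

rightFirst-move : ∀ {G} j → leftFirst (optR G j) ≡ false → rightFirst G ≡ true
rightFirst-move {mk _ _ b _} j p =
  trans (cong (isZero b ∨_) (anyFin-true⁺ b _ j (cong not p))) (∨-zeroʳ (isZero b))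

leftFirst-true⁻ : ∀ {G} → leftFirst G ≡ true →
  NoLeftMove G ⊎ ∃ λ i → rightFirst (optL G i) ≡ false
leftFirst-true⁻ {mk zero    _ _ _} _ = inj₁ refl
leftFirst-true⁻ {mk (suc a) _ _ _} p =
  inj₂ (Product.map₂ not-injective (anyFin-true⁻ (suc a) _ p))

rightFirst-true⁻ : ∀ {G} → rightFirst G ≡ true →
  NoRightMove G ⊎ ∃ λ j → leftFirst (optR G j) ≡ false
rightFirst-true⁻ {mk _ _ zero    _} _ = inj₁ refl
rightFirst-true⁻ {mk _ _ (suc b) _} p =
  inj₂ (Product.map₂ not-injective (anyFin-true⁻ (suc b) _ p))

leftFirst-⊕-noMove : ∀ {G X} → NoLeftMove G → NoLeftMove X → leftFirst (G ⊕ X) ≡ true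
leftFirst-⊕-noMove {mk zero _ _ _} {mk zero _ _ _} _ _ = refl

rightFirst-⊕-noMove : ∀ {G X} → NoRightMove G → NoRightMove X → rightFirst (G ⊕ X) ≡ true
rightFirst-⊕-noMove {mk _ _ zero _} {mk _ _ zero _} _ _ = refl

leftFirst-⊕-moveˡ : ∀ G X i → rightFirst (optL G i ⊕ X) ≡ false → leftFirst (G ⊕ X) ≡ true
leftFirst-⊕-moveˡ G@(mk a _ _ _) X@(mk c _ _ _) i p = leftFirst-move {G ⊕ X} (i ↑ˡ c) p′
  where
  p′ : rightFirst (optL (G ⊕ X) (i ↑ˡ c)) ≡ false
  p′ rewrite splitAt-↑ˡ a i c = p

leftFirst-⊕-moveʳ : ∀ G X j → rightFirst (G ⊕ optL X j) ≡ false → leftFirst (G ⊕ X) ≡ true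
leftFirst-⊕-moveʳ G@(mk a _ _ _) X@(mk c _ _ _) j p = leftFirst-move {G ⊕ X} (a ↑ʳ j) p′
  where
  p′ : rightFirst (optL (G ⊕ X) (a ↑ʳ j)) ≡ false
  p′ rewrite splitAt-↑ʳ a c j = p

rightFirst-⊕-moveˡ : ∀ G X i → leftFirst (optR G i ⊕ X) ≡ false → rightFirst (G ⊕ X) ≡ true
rightFirst-⊕-moveˡ G@(mk _ _ b _) X@(mk _ _ d _) i p = rightFirst-move {G ⊕ X} (i ↑ˡ d) p′
  where
  p′ : leftFirst (optR (G ⊕ X) (i ↑ˡ d)) ≡ false
  p′ rewrite splitAt-↑ˡ b i d = p

rightFirst-⊕-moveʳ : ∀ G X j → leftFirst (G ⊕ optR X j) ≡ false → rightFirst (G ⊕ X) ≡ true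
rightFirst-⊕-moveʳ G@(mk _ _ b _) X@(mk _ _ d _) j p = rightFirst-move {G ⊕ X} (b ↑ʳ j) p′
  where
  p′ : leftFirst (optR (G ⊕ X) (b ↑ʳ j)) ≡ false
  p′ rewrite splitAt-↑ʳ b d j = p

leftFirst-⊕-true⁻ : ∀ G X → leftFirst (G ⊕ X) ≡ true →
  (NoLeftMove G × NoLeftMove X)
  ⊎ (∃ λ i → rightFirst (optL G i ⊕ X) ≡ false)
  ⊎ (∃ λ j → rightFirst (G ⊕ optL X j) ≡ false)
leftFirst-⊕-true⁻ G@(mk a _ _ _) X@(mk _ _ _ _) p with leftFirst-true⁻ {G ⊕ X} p
... | inj₁ none = inj₁ (m+n≡0⇒m≡0 a none , m+n≡0⇒n≡0 a none)
... | inj₂ (k , q) with splitAt a k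
...   | inj₁ i = inj₂ (inj₁ (i , q))
...   | inj₂ j = inj₂ (inj₂ (j , q))

rightFirst-⊕-true⁻ : ∀ G X → rightFirst (G ⊕ X) ≡ true →
  (NoRightMove G × NoRightMove X)
  ⊎ (∃ λ i → leftFirst (optR G i ⊕ X) ≡ false)
  ⊎ (∃ λ j → leftFirst (G ⊕ optR X j) ≡ false)
rightFirst-⊕-true⁻ G@(mk _ _ b _) X@(mk _ _ _ _) p with rightFirst-true⁻ {G ⊕ X} p
... | inj₁ none = inj₁ (m+n≡0⇒m≡0 b none , m+n≡0⇒n≡0 b none)
... | inj₂ (k , q) with splitAt b k
...   | inj₁ i = inj₂ (inj₁ (i , q))
...   | inj₂ j = inj₂ (inj₂ (j , q))

leftEnd? : ∀ G → NoLeftMove G ⊎ Fin (nL G)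
leftEnd? (mk zero    _ _ _) = inj₁ refl
leftEnd? (mk (suc _) _ _ _) = inj₂ fzero

rightEnd? : ∀ G → NoRightMove G ⊎ Fin (nR G)
rightEnd? (mk _ _ zero    _) = inj₁ refl
rightEnd? (mk _ _ (suc _) _) = inj₂ fzero

blocking-optL : ∀ {X} → Blocking X → ∀ i → Blocking (optL X i)
blocking-optL b i H p = b H (viaL i p)

blocking-optR : ∀ {X} → Blocking X → ∀ j → Blocking (optR X j)
blocking-optR b j H p = b H (viaR j p)

LeftNeutral : Game → Set
LeftNeutral K = ∀ X → Blocking X → leftFirst (K ⊕ X) ≡ leftFirst X

RightNeutral : Game → Set
RightNeutral K = ∀ X → Blocking X → rightFirst (K ⊕ X) ≡ rightFirst X

Neutral : Game → Set
Neutral K = LeftNeutral K × RightNeutral K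

record LeftEndToNeutral (H : Game) : Set where
  constructor leftEndToNeutral
  field
    noLeftMove               : NoLeftMove H
    rightMove                : Fin (nR H)
    rightOptions-leftNeutral : ∀ j → LeftNeutral (optR H j)

record RightEndToNeutral (H : Game) : Set where
  constructor rightEndToNeutral
  field
    noRightMove              : NoRightMove H
    leftMove                 : Fin (nL H)
    leftOptions-rightNeutral : ∀ i → RightNeutral (optL H i)

-- Blocking is used here: once Right moves from the Left end Y to Y^R, either Y^R is again
-- a Left end or Left can move to a Left end Y^RL, and the argument repeats there.
rightFirst-⊕-leftEnd≡false : ∀ {H} → LeftEndToNeutral H →
  ∀ Y → Blocking Y → NoLeftMove Y → rightFirst (H ⊕ Y) ≡ false
leftFirst-⊕-leftEndOption : ∀ {H} → LeftEndToNeutral H →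
  ∀ Y → Blocking Y → ∀ i → NoLeftMove (optL Y i) → leftFirst (H ⊕ Y) ≡ true

rightFirst-⊕-leftEnd≡false {H} e Y@(mk _ _ _ R) bY noL =
  ¬-not (λ p → refute (rightFirst-⊕-true⁻ H Y p))
  where
  open LeftEndToNeutral e
  refute : (NoRightMove H × NoRightMove Y)
    ⊎ (∃ λ j → leftFirst (optR H j ⊕ Y) ≡ false)
    ⊎ (∃ λ j → leftFirst (H ⊕ optR Y j) ≡ false) → ⊥
  refute (inj₁ (noR , _)) = ¬Fin0 (subst Fin noR rightMove)
  refute (inj₂ (inj₁ (j , q))) =
    not-¬ (trans (rightOptions-leftNeutral j Y bY) (leftFirst-noMove {Y} noL)) q
  refute (inj₂ (inj₂ (j , q))) with proj₁ (bY Y here) noL j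
  ... | inj₁ noL′ = not-¬ (leftFirst-⊕-noMove {H} {R j} noLeftMove noL′) q
  ... | inj₂ (i , noL″) =
    not-¬ (leftFirst-⊕-leftEndOption e (R j) (blocking-optR bY j) i noL″) q

leftFirst-⊕-leftEndOption {H} e Y@(mk _ L _ _) bY i noL =
  leftFirst-⊕-moveʳ H Y i (rightFirst-⊕-leftEnd≡false e (L i) (blocking-optL bY i) noL)

leftFirst-⊕-rightEnd≡false : ∀ {H} → RightEndToNeutral H →
  ∀ Y → Blocking Y → NoRightMove Y → leftFirst (H ⊕ Y) ≡ false
rightFirst-⊕-rightEndOption : ∀ {H} → RightEndToNeutral H →
  ∀ Y → Blocking Y → ∀ j → NoRightMove (optR Y j) → rightFirst (H ⊕ Y) ≡ true

leftFirst-⊕-rightEnd≡false {H} e Y@(mk _ L _ _) bY noR =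
  ¬-not (λ p → refute (leftFirst-⊕-true⁻ H Y p))
  where
  open RightEndToNeutral e
  refute : (NoLeftMove H × NoLeftMove Y)
    ⊎ (∃ λ i → rightFirst (optL H i ⊕ Y) ≡ false)
    ⊎ (∃ λ i → rightFirst (H ⊕ optL Y i) ≡ false) → ⊥
  refute (inj₁ (noL , _)) = ¬Fin0 (subst Fin noL leftMove)
  refute (inj₂ (inj₁ (i , q))) =
    not-¬ (trans (leftOptions-rightNeutral i Y bY) (rightFirst-noMove {Y} noR)) q
  refute (inj₂ (inj₂ (i , q))) with proj₂ (bY Y here) noR i
  ... | inj₁ noR′ = not-¬ (rightFirst-⊕-noMove {H} {L i} noRightMove noR′) q
  ... | inj₂ (j , noR″) =
    not-¬ (rightFirst-⊕-rightEndOption e (L i) (blocking-optL bY i) j noR″) q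

rightFirst-⊕-rightEndOption {H} e Y@(mk _ _ _ R) bY j noR =
  rightFirst-⊕-moveʳ H Y j (leftFirst-⊕-rightEnd≡false e (R j) (blocking-optR bY j) noR)

leftFirst-⊕-leftEnds : ∀ {G} → (∀ i → LeftEndToNeutral (optL G i)) →
  ∀ X → Blocking X → (∀ i → rightFirst (G ⊕ optL X i) ≡ rightFirst (optL X i)) →
  leftFirst (G ⊕ X) ≡ leftFirst X
leftFirst-⊕-leftEnds {G} ends X bX ih = ⇔→≡ (mk⇔ to from)
  where
  to : leftFirst (G ⊕ X) ≡ true → leftFirst X ≡ true
  to p with leftFirst-⊕-true⁻ G X p
  ... | inj₁ (_ , noL)      = leftFirst-noMove {X} noL
  ... | inj₂ (inj₂ (i , q)) = leftFirst-move {X} i (trans (sym (ih i)) q)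
  ... | inj₂ (inj₁ (i , q)) =
    trans (sym (rightOptions-leftNeutral j X bX))
          (¬-not (λ r → not-¬ (rightFirst-⊕-moveˡ (optL G i) X j r) q))
    where open LeftEndToNeutral (ends i) renaming (rightMove to j)
  from : leftFirst X ≡ true → leftFirst (G ⊕ X) ≡ true
  from p with leftFirst-true⁻ {X} p | leftEnd? G
  ... | inj₂ (i , q) | _         = leftFirst-⊕-moveʳ G X i (trans (ih i) q)
  ... | inj₁ noL     | inj₁ noLG = leftFirst-⊕-noMove {G} {X} noLG noL
  ... | inj₁ noL     | inj₂ i    =
    leftFirst-⊕-moveˡ G X i (rightFirst-⊕-leftEnd≡false (ends i) X bX noL)

rightFirst-⊕-rightEnds : ∀ {G} → (∀ j → RightEndToNeutral (optR G j)) →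
  ∀ X → Blocking X → (∀ j → leftFirst (G ⊕ optR X j) ≡ leftFirst (optR X j)) →
  rightFirst (G ⊕ X) ≡ rightFirst X
rightFirst-⊕-rightEnds {G} ends X bX ih = ⇔→≡ (mk⇔ to from)
  where
  to : rightFirst (G ⊕ X) ≡ true → rightFirst X ≡ true
  to p with rightFirst-⊕-true⁻ G X p
  ... | inj₁ (_ , noR)      = rightFirst-noMove {X} noR
  ... | inj₂ (inj₂ (j , q)) = rightFirst-move {X} j (trans (sym (ih j)) q)
  ... | inj₂ (inj₁ (j , q)) =
    trans (sym (leftOptions-rightNeutral i X bX))
          (¬-not (λ r → not-¬ (leftFirst-⊕-moveˡ (optR G j) X i r) q))
    where open RightEndToNeutral (ends j) renaming (leftMove to i)
  from : rightFirst X ≡ true → rightFirst (G ⊕ X) ≡ true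
  from p with rightFirst-true⁻ {X} p | rightEnd? G
  ... | inj₂ (j , q) | _         = rightFirst-⊕-moveʳ G X j (trans (ih j) q)
  ... | inj₁ noR     | inj₁ noRG = rightFirst-⊕-noMove {G} {X} noRG noR
  ... | inj₁ noR     | inj₂ j    =
    rightFirst-⊕-moveˡ G X j (leftFirst-⊕-rightEnd≡false (ends j) X bX noR)

neutral-by-ends : ∀ G → (∀ i → LeftEndToNeutral (optL G i)) →
  (∀ j → RightEndToNeutral (optR G j)) → Neutral G
neutral-by-ends G hL hR = leftNeutral , rightNeutral
  where
  leftNeutral  : LeftNeutral G
  rightNeutral : RightNeutral G
  leftNeutral X@(mk _ L _ _) bX =
    leftFirst-⊕-leftEnds {G} hL X bX (λ i → rightNeutral (L i) (blocking-optL bX i))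
  rightNeutral X@(mk _ _ _ R) bX =
    rightFirst-⊕-rightEnds {G} hR X bX (λ j → leftNeutral (R j) (blocking-optR bX j))

zeroG-neutral : Neutral zeroG
zeroG-neutral = neutral-by-ends zeroG (λ ()) (λ ())

neutral⇒≡B-zeroG : ∀ K → Neutral K → K ≡B zeroG
neutral⇒≡B-zeroG _ (l , r) X bX =
  cong₂ outcomeOf (trans (l X bX) (sym (proj₁ zeroG-neutral X bX)))
                  (trans (r X bX) (sym (proj₂ zeroG-neutral X bX)))

leftFirst-⊕-rightEnd-transfer : ∀ {G G′} → RightEndToNeutral G → RightEndToNeutral G′ →
  ∀ X → Blocking X → (∀ i → rightFirst (G ⊕ optL X i) ≡ rightFirst (G′ ⊕ optL X i)) →
  leftFirst (G ⊕ X) ≡ true → leftFirst (G′ ⊕ X) ≡ true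
leftFirst-⊕-rightEnd-transfer {G} {G′} e e′ X bX ih p with leftFirst-⊕-true⁻ G X p
... | inj₁ (noL , _) = ⊥-elim (¬Fin0 (subst Fin noL (RightEndToNeutral.leftMove e)))
... | inj₂ (inj₂ (i , q)) = leftFirst-⊕-moveʳ G′ X i (trans (sym (ih i)) q)
... | inj₂ (inj₁ (i , q)) =
  leftFirst-⊕-moveˡ G′ X i′
    (trans (leftOptions-rightNeutral i′ X bX)
           (trans (sym (RightEndToNeutral.leftOptions-rightNeutral e i X bX)) q))
  where open RightEndToNeutral e′ renaming (leftMove to i′)

rightFirst-⊕-rightEnd-transfer : ∀ {G G′} → RightEndToNeutral G → RightEndToNeutral G′ →
  ∀ X → (∀ j → leftFirst (G ⊕ optR X j) ≡ leftFirst (G′ ⊕ optR X j)) →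
  rightFirst (G ⊕ X) ≡ true → rightFirst (G′ ⊕ X) ≡ true
rightFirst-⊕-rightEnd-transfer {G} {G′} e e′ X ih p with rightFirst-⊕-true⁻ G X p
... | inj₁ (_ , noRX) = rightFirst-⊕-noMove {G′} {X} (RightEndToNeutral.noRightMove e′) noRX
... | inj₂ (inj₁ (j , _)) = ⊥-elim (¬Fin0 (subst Fin (RightEndToNeutral.noRightMove e) j))
... | inj₂ (inj₂ (j , q)) = rightFirst-⊕-moveʳ G′ X j (trans (sym (ih j)) q)

rightEndsToNeutral-≡B : ∀ {G G′} → RightEndToNeutral G → RightEndToNeutral G′ → G ≡B G′
rightEndsToNeutral-≡B {G} {G′} e e′ X bX = uncurry (cong₂ outcomeOf) (same X bX)
  where
  same : ∀ X → Blocking X →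
    (leftFirst (G ⊕ X) ≡ leftFirst (G′ ⊕ X)) ×
    (rightFirst (G ⊕ X) ≡ rightFirst (G′ ⊕ X))
  same X@(mk _ L _ R) bX =
      ⇔→≡ (mk⇔ (leftFirst-⊕-rightEnd-transfer e e′ X bX ihL)
                (leftFirst-⊕-rightEnd-transfer e′ e X bX (sym ∘ ihL)))
    , ⇔→≡ (mk⇔ (rightFirst-⊕-rightEnd-transfer e e′ X ihR)
                (rightFirst-⊕-rightEnd-transfer e′ e X (sym ∘ ihR)))
    where
    ihL : ∀ i → rightFirst (G ⊕ L i) ≡ rightFirst (G′ ⊕ L i)
    ihL i = proj₂ (same (L i) (blocking-optL bX i))
    ihR : ∀ j → leftFirst (G ⊕ R j) ≡ leftFirst (G′ ⊕ R j)
    ihR j = proj₁ (same (R j) (blocking-optR bX j))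

bumpR-suc-leftEnd : ∀ n → LeftNeutral (bumpL n) → LeftEndToNeutral (bumpR (suc n))
bumpR-suc-leftEnd _ l = leftEndToNeutral refl fzero (λ _ → l)

bumpL-suc-rightEnd : ∀ n → RightNeutral (bumpR n) → RightEndToNeutral (bumpL (suc n))
bumpL-suc-rightEnd _ r = rightEndToNeutral refl fzero (λ _ → r)

bumpL-even-neutral : ∀ m → Neutral (bumpL (2 * m))
bumpL-even-neutral zero    = zeroG-neutral
bumpL-even-neutral (suc m) = subst (Neutral ∘ bumpL) (sym (*-suc 2 m))
  (neutral-by-ends (bumpL (2 + 2 * m))
    (λ _ → bumpR-suc-leftEnd (2 * m) (proj₁ (bumpL-even-neutral m))) (λ ()))

bumpR-even-neutral : ∀ m → Neutral (bumpR (2 * m))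
bumpR-even-neutral zero    = zeroG-neutral
bumpR-even-neutral (suc m) = subst (Neutral ∘ bumpR) (sym (*-suc 2 m))
  (neutral-by-ends (bumpR (2 + 2 * m))
    (λ ()) (λ _ → bumpL-suc-rightEnd (2 * m) (proj₂ (bumpR-even-neutral m))))

bumpR1⊕bumpL1-neutral : Neutral (bumpR 1 ⊕ bumpL 1)
bumpR1⊕bumpL1-neutral = neutral-by-ends (bumpR 1 ⊕ bumpL 1)
  (λ { fzero → leftEndToNeutral refl fzero (λ { fzero → proj₁ zeroG⊕zeroG-neutral }) })
  (λ { fzero → rightEndToNeutral refl fzero (λ { fzero → proj₂ zeroG⊕zeroG-neutral }) })
  where
  zeroG⊕zeroG-neutral : Neutral (zeroG ⊕ zeroG)
  zeroG⊕zeroG-neutral = neutral-by-ends (zeroG ⊕ zeroG) (λ ()) (λ ())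

lemma8 : ((e : ℕ) → Even e → bumpL e ≡B zeroG)
           × ((d : ℕ) → Odd d → bumpL d ≡B bumpL 1)
           × ((bumpR 1 ⊕ bumpL 1) ≡B zeroG)
lemma8 = even , odd , neutral⇒≡B-zeroG (bumpR 1 ⊕ bumpL 1) bumpR1⊕bumpL1-neutral
  where
  even : (e : ℕ) → Even e → bumpL e ≡B zeroG
  even _ (m , refl) = neutral⇒≡B-zeroG (bumpL (2 * m)) (bumpL-even-neutral m)
  odd : (d : ℕ) → Odd d → bumpL d ≡B bumpL 1
  odd _ (m , refl) rewrite +-comm (2 * m) 1 =
    rightEndsToNeutral-≡B (bumpL-suc-rightEnd (2 * m) (proj₂ (bumpR-even-neutral m)))
                          (bumpL-suc-rightEnd 0 (proj₂ zeroG-neutral))
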